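{- Let $k,q\in\mathbb{Z}_{>0}$ with $k\ge2$. The code $\mathcal{N}_k(q)$ has no codewords of odd weight less than $k$. The code $\mathcal{Z}_k(q)$ has no codewords of odd weight at most $k$. Furthermore, if $k\ne2$, neither $\mathcal{N}_k(q)$ nor $\mathcal{Z}_k(q)$ has a codeword of weight $2$.
   Context: $\mathbb{Z}_q:=\mathbb{Z}/q\mathbb{Z}$. Let $I_k$ be the $k\times k$ identity matrix, $J_k$ the $k\times k$ all-ones matrix, $1_k$ the all-ones column vector of length $k$. Define the integer matrices $\widetilde N_k:=(I_k\mid J_k-I_k)\in\mathrm{Mat}_{k\times 2k}(\mathbb{Z})$ and $\widetilde Z_k:=(I_k\mid J_k-I_k\mid 1_k)\in\mathrm{Mat}_{k\times(2k+1)}(\mathbb{Z})$. For an integer matrix $G$ with $k$ rows, $C_G(q):=\{uG\mid u\in\mathbb{Z}_q^k\}$, and $\mathcal{N}_k(q):=C_{\widetilde N_k}(q)$, $\mathcal{Z}_k(q):=C_{\widetilde Z_k}(q)$. The weight of a codeword is its number of nonzero entries. -}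

module Defs where

open import Data.Nat using (ℕ; zero; suc; _+_; _*_; _%_; NonZero)
open import Data.Nat.Properties using (_≟_)
open import Data.Fin using (Fin; toℕ; _↑ˡ_; _↑ʳ_; splitAt)
open import Data.Fin.Properties as FinP using ()
open import Data.Sum using (inj₁; inj₂)
open import Data.Vec.Functional using (Vector; foldr)
open import Data.Product using (Σ; _×_; ∃-syntax)
open import Relation.Binary.PropositionalEquality using (_≡_)
open import Relation.Nullary using (does)
open import Data.Bool using (if_then_else_)

∑ : ∀ {n} → (Fin n → ℕ) → ℕ
∑ f = foldr _+_ 0 f

-- Integer matrices with nonnegative entries (all generator matrices here are 0/1)
Mat : ℕ → ℕ → Set
Mat k n = Fin k → Fin n → ℕ

δ : ∀ {k} → Fin k → Fin k → ℕ
δ i j = if does (i FinP.≟ j) then 1 else 0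

-- Ñ_k = (I_k | J_k - I_k), a k × 2k matrix
Ñ : (k : ℕ) → Mat k (k + k)
Ñ k i j with splitAt k j
... | inj₁ a = δ i a
... | inj₂ b = if does (i FinP.≟ b) then 0 else 1

-- Z̃_k = (I_k | J_k - I_k | 1_k), a k × (2k+1) matrix
Z̃ : (k : ℕ) → Mat k ((k + k) + 1)
Z̃ k i j with splitAt (k + k) j
... | inj₁ a = Ñ k i a
... | inj₂ _ = 1

-- Elements of ℤ_q are represented by Fin q; the codeword uG ∈ ℤ_q^n,
-- with each coordinate represented by its residue in {0,…,q-1}.
codeword : ∀ {k n} (q : ℕ) .{{_ : NonZero q}} → Mat k n → (Fin k → Fin q) → Fin n → ℕ
codeword q G u j = (∑ λ i → toℕ (u i) * G i j) % q

_∈C[_,_] : ∀ {k n} → (Fin n → ℕ) → Mat k n → (q : ℕ) → .{{_ : NonZero q}} → Set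
c ∈C[ G , q ] = ∃[ u ] (∀ j → codeword q G u j ≡ c j)

weight : ∀ {n} → (Fin n → ℕ) → ℕ
weight c = ∑ λ j → if does (c j ≟ 0) then 0 else 1

Odd : ℕ → Set
Odd n = n % 2 ≡ 1

{-# OPTIONS --safe #-}
-- Write x for the message u read in ℕ and s for its coordinate sum mod q. Coordinate b of
-- the right block of uÑ is the residue of the sum of x minus x b, so it pairs with x b:
-- their sum is s mod q. If s = 0 the pair is zero or nonzero together, so the weight is
-- twice the weight of x, and that weight is not 1, since then s would be the single
-- nonzero entry of x. If s ≠ 0 every pair has a nonzero member, so the weight is at
-- least k. The extra column of Z̃ adds the coordinate s, which is zero in the first case
-- and one more nonzero coordinate in the second.
module Submission where

open import Defs
open import Data.Bool using (if_then_else_)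
open import Data.Fin using (Fin; zero; suc; toℕ; _↑ˡ_; _↑ʳ_)
open import Data.Fin.Properties as Fin using (splitAt-↑ˡ; splitAt-↑ʳ; toℕ<n)
open import Data.Nat using (ℕ; zero; suc; _+_; _*_; _%_; _<_; _≤_; ⌊_/2⌋; NonZero; z≤n; s≤s)
open import Data.Nat.DivMod using (m<n⇒m%n≡m; m*n%n≡0; %-remove-+ʳ)
open import Data.Nat.Divisibility using (m%n≡0⇒n∣m)
open import Data.Nat.Properties
open import Algebra.Properties.CommutativeMonoid.Sum +-0-commutativeMonoid
  using (sum-cong-≗; sum-replicate-zero; ∑-distrib-+)
open import Data.Product using (_×_; _,_; ∃-syntax)
open import Function using (_∘_)
open import Relation.Binary.PropositionalEquality
open import Relation.Nullary using (¬_; does; yes; no; contradiction)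

-- weight c unfolds to ∑ (nonzero ∘ c).
nonzero : ℕ → ℕ
nonzero n = if does (n ≟ 0) then 0 else 1

nonzero-≢0 : ∀ {n} → n ≢ 0 → nonzero n ≡ 1
nonzero-≢0 {zero}  n≢0 = contradiction refl n≢0
nonzero-≢0 {suc n} _   = refl

¬odd-double : ∀ a → ¬ Odd (a + a)
¬odd-double a odd = 0≢1+n (begin
  0                 ≡⟨ m*n%n≡0 a 2 ⟨
  a * 2 % 2         ≡⟨ cong (_% 2) (*-comm a 2) ⟩
  (a + (a + 0)) % 2 ≡⟨ cong (λ n → (a + n) % 2) (+-identityʳ a) ⟩
  (a + a) % 2       ≡⟨ odd ⟩
  1                 ∎)
  where open ≡-Reasoning

double≢2 : ∀ {a} → a ≢ 1 → a + a ≢ 2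
double≢2 {a} a≢1 a+a≡2 = a≢1 (trans (n≡⌊n+n/2⌋ a) (cong ⌊_/2⌋ a+a≡2))

δ̄ : ∀ {k} → Fin k → Fin k → ℕ
δ̄ i j = if does (i Fin.≟ j) then 0 else 1

δ+δ̄≡1 : ∀ {k} (i j : Fin k) → δ i j + δ̄ i j ≡ 1
δ+δ̄≡1 i j with i Fin.≟ j
... | yes _ = refl
... | no  _ = refl

∑-↑ : ∀ m {n} (f : Fin (m + n) → ℕ) → ∑ f ≡ ∑ (f ∘ (_↑ˡ n)) + ∑ (f ∘ (m ↑ʳ_))
∑-↑ zero    f = refl
∑-↑ (suc m) f = trans (cong (f zero +_) (∑-↑ m (f ∘ suc))) (sym (+-assoc (f zero) _ _))

∑-*0 : ∀ {n} (x : Fin n → ℕ) → ∑ (λ i → x i * 0) ≡ 0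
∑-*0 {n} x = trans (sum-cong-≗ (*-zeroʳ ∘ x)) (sum-replicate-zero n)

∑-*δ : ∀ {n} (x : Fin n → ℕ) a → ∑ (λ i → x i * δ i a) ≡ x a
∑-*δ x zero    = trans (cong₂ _+_ (*-identityʳ (x zero)) (∑-*0 (x ∘ suc))) (+-identityʳ (x zero))
∑-*δ x (suc a) = trans (cong (_+ ∑ (λ i → x (suc i) * δ i a)) (*-zeroʳ (x zero))) (∑-*δ (x ∘ suc) a)

∑-*δ̄ : ∀ {n} (x : Fin n → ℕ) b → x b + ∑ (λ i → x i * δ̄ i b) ≡ ∑ x
∑-*δ̄ x b = begin
  x b + ∑ (λ i → x i * δ̄ i b)                      ≡⟨ cong (_+ ∑ (λ i → x i * δ̄ i b)) (∑-*δ x b) ⟨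
  ∑ (λ i → x i * δ i b) + ∑ (λ i → x i * δ̄ i b)    ≡⟨ ∑-distrib-+ (λ i → x i * δ i b) (λ i → x i * δ̄ i b) ⟨
  ∑ (λ i → x i * δ i b + x i * δ̄ i b)              ≡⟨ sum-cong-≗ split ⟩
  ∑ x                                                ∎
  where
  open ≡-Reasoning
  split : ∀ i → x i * δ i b + x i * δ̄ i b ≡ x i
  split i = trans (sym (*-distribˡ-+ (x i) _ _)) (trans (cong (x i *_) (δ+δ̄≡1 i b)) (*-identityʳ (x i)))

∑-≥-size : ∀ {n} (f : Fin n → ℕ) → (∀ i → 1 ≤ f i) → n ≤ ∑ f
∑-≥-size {zero}  f _   = z≤n
∑-≥-size {suc n} f 1≤f = +-mono-≤ (1≤f zero) (∑-≥-size (f ∘ suc) (1≤f ∘ suc))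

weight-cong : ∀ {n} {c d : Fin n → ℕ} → (∀ j → c j ≡ d j) → weight c ≡ weight d
weight-cong c≡d = sum-cong-≗ (cong nonzero ∘ c≡d)

weight≡0⇒∑≡0 : ∀ {n} (x : Fin n → ℕ) → weight x ≡ 0 → ∑ x ≡ 0
weight≡0⇒∑≡0 {zero}  x _ = refl
weight≡0⇒∑≡0 {suc n} x w≡0 with x zero
... | zero = weight≡0⇒∑≡0 (x ∘ suc) w≡0

weight≡1⇒∑-single : ∀ {n} (x : Fin n → ℕ) → weight x ≡ 1 → ∃[ i ] (x i ≢ 0 × ∑ x ≡ x i)
weight≡1⇒∑-single {suc n} x w≡1 with x zero in x₀≡
... | zero with weight≡1⇒∑-single (x ∘ suc) w≡1
...   | i , xi≢0 , ∑≡xi = suc i , xi≢0 , ∑≡xi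
weight≡1⇒∑-single {suc n} x w≡1 | suc m =
  zero , (λ x₀≡0 → 1+n≢0 (trans (sym x₀≡) x₀≡0)) ,
  trans (cong (suc m +_) (weight≡0⇒∑≡0 (x ∘ suc) (suc-injective w≡1)))
        (trans (+-identityʳ (suc m)) (sym x₀≡))

module _ {q : ℕ} .{{_ : NonZero q}} where

  nonzero-balanced : ∀ {l r} → l < q → (l + r) % q ≡ 0 → nonzero (r % q) ≡ nonzero l
  nonzero-balanced {zero}  _   r%q≡0 = cong nonzero r%q≡0
  nonzero-balanced {suc l} l<q [l+r]%q≡0 = nonzero-≢0 λ r%q≡0 →
    1+n≢0 (trans (sym (m<n⇒m%n≡m l<q))
                 (trans (sym (%-remove-+ʳ (suc l) (m%n≡0⇒n∣m _ q r%q≡0))) [l+r]%q≡0))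

  nonzero-covered : ∀ l r → (l + r) % q ≢ 0 → 1 ≤ nonzero l + nonzero (r % q)
  nonzero-covered zero    r r%q≢0 = ≤-reflexive (sym (nonzero-≢0 r%q≢0))
  nonzero-covered (suc l) r _     = s≤s z≤n

  onCodewords : ∀ {k n} {G : Mat k n} (P : ℕ → Set) →
                (∀ u → P (weight (codeword q G u))) → ∀ c → c ∈C[ G , q ] → P (weight c)
  onCodewords P P-uG c (u , uG≡c) = subst P (weight-cong uG≡c) (P-uG u)

data CodewordWeights (k wN wZ : ℕ) : Set where
  doubled : ∀ a → a ≢ 1 → wN ≡ a + a → wZ ≡ a + a → CodewordWeights k wN wZ
  heavy   : k ≤ wN → wZ ≡ suc wN → CodewordWeights k wN wZ

module _ {k wN wZ : ℕ} where

  odd-wN⇒¬wN<k : CodewordWeights k wN wZ → Odd wN → ¬ wN < k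
  odd-wN⇒¬wN<k (doubled a _ refl _) odd = contradiction odd (¬odd-double a)
  odd-wN⇒¬wN<k (heavy k≤wN _)       _   = ≤⇒≯ k≤wN

  odd-wZ⇒¬wZ≤k : CodewordWeights k wN wZ → Odd wZ → ¬ wZ ≤ k
  odd-wZ⇒¬wZ≤k (doubled a _ _ refl) odd = contradiction odd (¬odd-double a)
  odd-wZ⇒¬wZ≤k (heavy k≤wN refl)    _   = ≤⇒≯ k≤wN

  wN≢2 : 2 ≤ k → k ≢ 2 → CodewordWeights k wN wZ → wN ≢ 2
  wN≢2 _   _   (doubled a a≢1 refl _) = double≢2 a≢1
  wN≢2 2≤k k≢2 (heavy k≤wN _) wN≡2    = k≢2 (≤-antisym (subst (k ≤_) wN≡2 k≤wN) 2≤k)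

  wZ≢2 : 2 ≤ k → CodewordWeights k wN wZ → wZ ≢ 2
  wZ≢2 _   (doubled a a≢1 _ refl) = double≢2 a≢1
  wZ≢2 2≤k (heavy k≤wN refl) wZ≡2 = <⇒≱ 2≤k (subst (k ≤_) (suc-injective wZ≡2) k≤wN)

module _ {q : ℕ} .{{_ : NonZero q}} {k : ℕ} (u : Fin k → Fin q) where

  private
    x : Fin k → ℕ
    x = toℕ ∘ u

    s : ℕ
    s = ∑ x % q

    r : Fin k → ℕ
    r b = ∑ (λ i → x i * δ̄ i b)

    wN wZ : ℕ
    wN = weight (codeword q (Ñ k) u)
    wZ = weight (codeword q (Z̃ k) u)

  codeword-Ñ-↑ˡ : ∀ a → codeword q (Ñ k) u (a ↑ˡ k) ≡ x a
  codeword-Ñ-↑ˡ a = begin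
    ∑ (λ i → x i * Ñ k i (a ↑ˡ k)) % q ≡⟨ cong (_% q) (sum-cong-≗ λ i → cong (x i *_) Ñ-↑ˡ) ⟩
    ∑ (λ i → x i * δ i a) % q          ≡⟨ cong (_% q) (∑-*δ x a) ⟩
    x a % q                            ≡⟨ m<n⇒m%n≡m (toℕ<n (u a)) ⟩
    x a                                ∎
    where
    open ≡-Reasoning
    Ñ-↑ˡ : ∀ {i} → Ñ k i (a ↑ˡ k) ≡ δ i a
    Ñ-↑ˡ rewrite splitAt-↑ˡ k a k = refl

  codeword-Ñ-↑ʳ : ∀ b → codeword q (Ñ k) u (k ↑ʳ b) ≡ r b % q
  codeword-Ñ-↑ʳ b = cong (_% q) (sum-cong-≗ λ i → cong (x i *_) Ñ-↑ʳ)
    where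
    Ñ-↑ʳ : ∀ {i} → Ñ k i (k ↑ʳ b) ≡ δ̄ i b
    Ñ-↑ʳ rewrite splitAt-↑ʳ k k b = refl

  codeword-Z̃-↑ˡ : ∀ j → codeword q (Z̃ k) u (j ↑ˡ 1) ≡ codeword q (Ñ k) u j
  codeword-Z̃-↑ˡ j = cong (_% q) (sum-cong-≗ λ i → cong (x i *_) Z̃-↑ˡ)
    where
    Z̃-↑ˡ : ∀ {i} → Z̃ k i (j ↑ˡ 1) ≡ Ñ k i j
    Z̃-↑ˡ rewrite splitAt-↑ˡ (k + k) j 1 = refl

  codeword-Z̃-last : codeword q (Z̃ k) u ((k + k) ↑ʳ zero) ≡ s
  codeword-Z̃-last = cong (_% q) (sum-cong-≗ λ i → trans (cong (x i *_) Z̃-last) (*-identityʳ (x i)))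
    where
    Z̃-last : ∀ {i} → Z̃ k i ((k + k) ↑ʳ zero) ≡ 1
    Z̃-last rewrite splitAt-↑ʳ (k + k) 1 zero = refl

  weight-Ñ : wN ≡ weight x + weight (λ b → r b % q)
  weight-Ñ = trans (∑-↑ k (nonzero ∘ codeword q (Ñ k) u))
    (cong₂ _+_ (weight-cong codeword-Ñ-↑ˡ) (weight-cong codeword-Ñ-↑ʳ))

  weight-Z̃ : wZ ≡ wN + nonzero s
  weight-Z̃ = trans (∑-↑ (k + k) (nonzero ∘ codeword q (Z̃ k) u))
    (cong₂ _+_ (weight-cong codeword-Z̃-↑ˡ) (trans (+-identityʳ _) (cong nonzero codeword-Z̃-last)))

  column-sum : ∀ b → (x b + r b) % q ≡ s
  column-sum b = cong (_% q) (∑-*δ̄ x b)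

  weight-message≢1 : s ≡ 0 → weight x ≢ 1
  weight-message≢1 s≡0 w≡1 with weight≡1⇒∑-single x w≡1
  ... | i , xi≢0 , ∑≡xi =
    xi≢0 (trans (sym (m<n⇒m%n≡m (toℕ<n (u i)))) (trans (cong (_% q) (sym ∑≡xi)) s≡0))

  weight-Ñ-doubled : s ≡ 0 → wN ≡ weight x + weight x
  weight-Ñ-doubled s≡0 = trans weight-Ñ (cong (weight x +_) (sum-cong-≗ λ b →
    nonzero-balanced (toℕ<n (u b)) (trans (column-sum b) s≡0)))

  weight-Ñ-≥k : s ≢ 0 → k ≤ wN
  weight-Ñ-≥k s≢0 = subst (k ≤_) pairs≡wN
    (∑-≥-size _ λ b → nonzero-covered (x b) (r b) (s≢0 ∘ trans (sym (column-sum b))))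
    where
    pairs≡wN : ∑ (λ b → nonzero (x b) + nonzero (r b % q)) ≡ wN
    pairs≡wN = trans (∑-distrib-+ (nonzero ∘ x) (λ b → nonzero (r b % q))) (sym weight-Ñ)

  codewordWeights : CodewordWeights k wN wZ
  codewordWeights with s ≟ 0
  ... | yes s≡0 = doubled (weight x) (weight-message≢1 s≡0) (weight-Ñ-doubled s≡0) (begin
    wZ                      ≡⟨ weight-Z̃ ⟩
    wN + nonzero s          ≡⟨ cong₂ _+_ (weight-Ñ-doubled s≡0) (cong nonzero s≡0) ⟩
    weight x + weight x + 0 ≡⟨ +-identityʳ _ ⟩
    weight x + weight x     ∎)
    where open ≡-Reasoning
  ... | no s≢0 = heavy (weight-Ñ-≥k s≢0) (begin
    wZ             ≡⟨ weight-Z̃ ⟩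
    wN + nonzero s ≡⟨ cong (wN +_) (nonzero-≢0 s≢0) ⟩
    wN + 1         ≡⟨ +-comm wN 1 ⟩
    suc wN         ∎)
    where open ≡-Reasoning

proposition5p1 : (k q : ℕ) → .{{_ : NonZero q}} → 2 ≤ k →
    ((c : Fin (k + k) → ℕ) → c ∈C[ Ñ k , q ] → Odd (weight c) → ¬ (weight c < k))
    × ((c : Fin ((k + k) + 1) → ℕ) → c ∈C[ Z̃ k , q ] → Odd (weight c) → ¬ (weight c ≤ k))
    × (k ≢ 2 →
        ((c : Fin (k + k) → ℕ) → c ∈C[ Ñ k , q ] → weight c ≢ 2)
        × ((c : Fin ((k + k) + 1) → ℕ) → c ∈C[ Z̃ k , q ] → weight c ≢ 2))
proposition5p1 k q 2≤k =
    onCodewords (λ w → Odd w → ¬ w < k) (odd-wN⇒¬wN<k ∘ codewordWeights)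
  , onCodewords (λ w → Odd w → ¬ w ≤ k) (odd-wZ⇒¬wZ≤k ∘ codewordWeights)
  , λ k≢2 → onCodewords (_≢ 2) (wN≢2 2≤k k≢2 ∘ codewordWeights)
          , onCodewords (_≢ 2) (wZ≢2 2≤k ∘ codewordWeights)
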